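{- Let $G$ be a finite abelian group, written multiplicatively with identity $1$, with $|G|=2m$ for some positive integer $m$. Suppose $N\subseteq G$ satisfies $\{1,a\}\subseteq N$ for some $a\ne 1$ with $a^2=1$, and $|N|$ is odd. Then $N$ is not a direct factor of $G$.
   Context: For an abelian group $G$ (written multiplicatively) and subsets $A,B\subseteq G$, the equation $G=A\cdot B$ is a factorization of $G$ if every $g\in G$ can be written uniquely as $g=ab$ with $a\in A$, $b\in B$. A nonempty subset $A\subseteq G$ is a direct factor of $G$ if there exists a subset $B\subseteq G$ such that $G=A\cdot B$ is a factorization. -}

module Defs where

open import Data.Nat using (ℕ)
open import Data.Fin using (Fin)
open import Data.Fin.Subset using (Subset; _∈_; Nonempty)
open import Data.Product using (Σ; ∃; _×_; _,_)
open import Relation.Binary.PropositionalEquality using (_≡_)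
open import Algebra.Structures using (IsAbelianGroup)
open import Level using (0ℓ)

-- A finite abelian group of order n, presented (up to isomorphism) on the
-- carrier Fin n with propositional equality.
record FiniteAbelianGroup (n : ℕ) : Set where
  field
    _∙_ : Fin n → Fin n → Fin n
    ε   : Fin n
    _⁻¹ : Fin n → Fin n
    isAbelianGroup : IsAbelianGroup _≡_ _∙_ ε _⁻¹

module _ {n : ℕ} (G : FiniteAbelianGroup n) where
  open FiniteAbelianGroup G

  IsFactorization : Subset n → Subset n → Set
  IsFactorization A B =
    ((g : Fin n) → Σ (Fin n) λ a → Σ (Fin n) λ b → a ∈ A × b ∈ B × (a ∙ b) ≡ g)
    × ((a b a′ b′ : Fin n) → a ∈ A → b ∈ B → a′ ∈ A → b′ ∈ B →
         (a ∙ b) ≡ (a′ ∙ b′) → a ≡ a′ × b ≡ b′)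

  IsDirectFactor : Subset n → Set
  IsDirectFactor A = Nonempty A × Σ (Subset n) λ B → IsFactorization A B

{-# OPTIONS --safe #-}
module Submission where

open import Algebra.Bundles using (AbelianGroup; Group)
import Algebra.Properties.CommutativeSemigroup as CommutativeSemigroupProperties
import Algebra.Properties.Group as GroupProperties
open import Data.Fin using (Fin; zero; suc)
open import Data.Fin.Properties using (_≟_; any?; injective⇒≤)
open import Data.Fin.Subset using (Subset; _∈_; _∉_; ∣_∣; _-_; Nonempty; inside; outside)
open import Data.Fin.Subset.Properties
  using (_∈?_; p─⊥≡p; p─q⊆p; x∈p∧x≢y⇒x∈p-y; nonempty?; Empty-unique; ∣⊥∣≡0)
open import Data.Nat using (ℕ; zero; suc; _+_; _*_; _<_)
open import Data.Nat.Divisibility using (_∣_; _∣0; ∣-refl; ∣m∣n⇒∣m+n)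
import Data.Nat.Properties as ℕ
open import Data.Vec.Base using (_∷_; here; there)
open import Data.Product using (∃; _×_; _,_; proj₁; proj₂)
open import Function.Definitions using (Injective)
open import Level using (0ℓ)
open import Relation.Binary.PropositionalEquality
open import Relation.Nullary using (¬_; yes; no; contradiction)
open import Relation.Nullary.Decidable using (_×-dec_)

open import Defs

-- Suppose G = N · B.  For every g, x ↦ (the N-part of x⁻¹ g) is an involution of N
-- (because G is abelian), so since ∣N∣ is odd it has a fixed point x, and then
-- g = x² b with b ∈ B.  Hence the map x b ↦ x² b (x ∈ N, b ∈ B) is onto, so by
-- finiteness one-to-one; but it sends b and a b to the same element when a² = 1.

∣p∣≡1+∣p-x∣ : ∀ {n} {p : Subset n} {x : Fin n} → x ∈ p → ∣ p ∣ ≡ suc ∣ p - x ∣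
∣p∣≡1+∣p-x∣ {p = inside  ∷ p} here        = cong (λ q → suc ∣ q ∣) (sym (p─⊥≡p p))
∣p∣≡1+∣p-x∣ {p = inside  ∷ p} (there x∈p) = cong suc (∣p∣≡1+∣p-x∣ x∈p)
∣p∣≡1+∣p-x∣ {p = outside ∷ p} (there x∈p) = ∣p∣≡1+∣p-x∣ x∈p

x∉p-x : ∀ {n} {p : Subset n} (x : Fin n) → x ∉ p - x
x∉p-x {p = _ ∷ _} zero    ()
x∉p-x {p = _ ∷ _} (suc x) (there x∈p-x) = x∉p-x x x∈p-x

x∈p-y⇒x≢y : ∀ {n} {p : Subset n} {x y : Fin n} → x ∈ p - y → x ≢ y
x∈p-y⇒x≢y {x = x} x∈p-x refl = x∉p-x x x∈p-x

∣p∣≡1+k⇒Nonempty : ∀ {n k} {p : Subset n} → ∣ p ∣ ≡ suc k → Nonempty p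
∣p∣≡1+k⇒Nonempty {n} {p = p} ∣p∣≡1+k with nonempty? p
... | yes ne = ne
... | no  empty = contradiction
  (trans (sym (∣⊥∣≡0 n)) (trans (cong ∣_∣ (sym (Empty-unique empty))) ∣p∣≡1+k)) λ ()

module _ {n : ℕ} (f : Fin n → Fin n) where

  InvolutionOn : Subset n → Set
  InvolutionOn p = ∀ {x} → x ∈ p → f x ∈ p × f (f x) ≡ x

  FixedPointFreeOn : Subset n → Set
  FixedPointFreeOn p = ∀ {x} → x ∈ p → f x ≢ x

  involutionOn-remove-orbit : ∀ {p x} → InvolutionOn p → x ∈ p →
                              InvolutionOn (p - x - f x)
  involutionOn-remove-orbit {p} {x} inv x∈p {z} z∈q =
    x∈p∧x≢y⇒x∈p-y (x∈p∧x≢y⇒x∈p-y (proj₁ (inv z∈p)) fz≢x) fz≢fx , proj₂ (inv z∈p)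
    where
    z∈p-x : z ∈ p - x
    z∈p-x = p─q⊆p _ _ z∈q
    z∈p : z ∈ p
    z∈p = p─q⊆p _ _ z∈p-x
    fz≢x : f z ≢ x
    fz≢x fz≡x = x∈p-y⇒x≢y z∈q (trans (sym (proj₂ (inv z∈p))) (cong f fz≡x))
    fz≢fx : f z ≢ f x
    fz≢fx fz≡fx = x∈p-y⇒x≢y z∈p-x
      (trans (sym (proj₂ (inv z∈p))) (trans (cong f fz≡fx) (proj₂ (inv x∈p))))

  ∣p∣≡2+∣p-x-fx∣ : ∀ {p x} → InvolutionOn p → FixedPointFreeOn p → x ∈ p →
                   ∣ p ∣ ≡ 2 + ∣ p - x - f x ∣
  ∣p∣≡2+∣p-x-fx∣ inv fpf x∈p = trans (∣p∣≡1+∣p-x∣ x∈p)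
    (cong suc (∣p∣≡1+∣p-x∣ (x∈p∧x≢y⇒x∈p-y (proj₁ (inv x∈p)) (fpf x∈p))))

  fixedPointFree-involution⇒even : ∀ {p} → InvolutionOn p → FixedPointFreeOn p →
                                   2 ∣ ∣ p ∣
  fixedPointFree-involution⇒even inv fpf = go _ refl inv fpf
    where
    go : ∀ k {p} → ∣ p ∣ ≡ k → InvolutionOn p → FixedPointFreeOn p → 2 ∣ k
    go zero    _ _ _ = 2 ∣0
    go (suc k) {p} ∣p∣≡1+k inv fpf with x , x∈p ← ∣p∣≡1+k⇒Nonempty ∣p∣≡1+k =
      removeOrbit k (ℕ.suc-injective (trans (sym ∣p∣≡1+k) (∣p∣≡2+∣p-x-fx∣ inv fpf x∈p)))
      where
      q = p - x - f x
      -- matching on j (rather than recursing on ∣ q ∣) keeps the recursion structural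
      removeOrbit : ∀ j → j ≡ suc ∣ q ∣ → 2 ∣ suc j
      removeOrbit zero    ()
      removeOrbit (suc j) j≡∣q∣ = ∣m∣n⇒∣m+n ∣-refl
        (go j (sym (ℕ.suc-injective j≡∣q∣)) (involutionOn-remove-orbit inv x∈p)
            (λ z∈q → fpf (p─q⊆p _ _ (p─q⊆p _ _ z∈q))))

  odd⇒involution-has-fixedPoint : ∀ {p} → InvolutionOn p → ¬ 2 ∣ ∣ p ∣ →
                                  ∃ λ x → x ∈ p × f x ≡ x
  odd⇒involution-has-fixedPoint {p} inv odd with any? (λ x → (x ∈? p) ×-dec (f x ≟ x))
  ... | yes fixedPoint = fixedPoint
  ... | no  none       = contradiction
    (fixedPointFree-involution⇒even inv (λ x∈p fx≡x → none (_ , x∈p , fx≡x))) odd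

module _ {n : ℕ} {h s : Fin n → Fin n} (h∘s≗id : ∀ y → h (s y) ≡ y) where

  section⇒retraction : ∀ x → s (h x) ≡ x
  section⇒retraction x with s (h x) ≟ x
  ... | yes s∘h≡id = s∘h≡id
  ... | no  s∘h≢id = contradiction (injective⇒≤ x∷s-injective) ℕ.1+n≰n
    where
    s-injective : Injective _≡_ _≡_ s
    s-injective {y} {z} sy≡sz = trans (sym (h∘s≗id y)) (trans (cong h sy≡sz) (h∘s≗id z))
    x∉image : ∀ y → s y ≢ x
    x∉image y sy≡x = s∘h≢id (subst (λ z → s (h z) ≡ z) sy≡x (cong s (h∘s≗id y)))
    x∷s : Fin (suc n) → Fin n
    x∷s zero    = x
    x∷s (suc y) = s y
    x∷s-injective : Injective _≡_ _≡_ x∷s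
    x∷s-injective {zero}  {zero}  _     = refl
    x∷s-injective {zero}  {suc z} x≡sz  = contradiction (sym x≡sz) (x∉image z)
    x∷s-injective {suc y} {zero}  sy≡x  = contradiction sy≡x (x∉image y)
    x∷s-injective {suc y} {suc z} sy≡sz = cong suc (s-injective sy≡sz)

  section⇒injective : Injective _≡_ _≡_ h
  section⇒injective {u} {v} hu≡hv =
    trans (sym (section⇒retraction u)) (trans (cong s hu≡hv) (section⇒retraction v))

module Factorization {n : ℕ} (G : FiniteAbelianGroup n) {N B : Subset n}
                     (G≡N·B : IsFactorization G N B) where

  open FiniteAbelianGroup G

  abelianGroup : AbelianGroup 0ℓ 0ℓ
  abelianGroup = record { isAbelianGroup = isAbelianGroup }

  open Group (AbelianGroup.group abelianGroup) using (_\\_; identityˡ; assoc)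
  open GroupProperties (AbelianGroup.group abelianGroup) using (\\-leftDividesˡ; \\-leftDividesʳ)
  open CommutativeSemigroupProperties (AbelianGroup.commutativeSemigroup abelianGroup)
    using (x∙yz≈y∙xz)
  open ≡-Reasoning

  nPart : Fin n → Fin n
  nPart g = proj₁ (proj₁ G≡N·B g)

  bPart : Fin n → Fin n
  bPart g = proj₁ (proj₂ (proj₁ G≡N·B g))

  nPart∈N : ∀ g → nPart g ∈ N
  nPart∈N g = proj₁ (proj₂ (proj₂ (proj₁ G≡N·B g)))

  bPart∈B : ∀ g → bPart g ∈ B
  bPart∈B g = proj₁ (proj₂ (proj₂ (proj₂ (proj₁ G≡N·B g))))

  nPart∙bPart : ∀ g → nPart g ∙ bPart g ≡ g
  nPart∙bPart g = proj₂ (proj₂ (proj₂ (proj₂ (proj₁ G≡N·B g))))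

  factor-unique : ∀ {x b g} → x ∈ N → b ∈ B → x ∙ b ≡ g → nPart g ≡ x × bPart g ≡ b
  factor-unique {x} {b} {g} x∈N b∈B x∙b≡g = proj₂ G≡N·B _ _ x b (nPart∈N g) (bPart∈B g)
    x∈N b∈B (trans (nPart∙bPart g) (sym x∙b≡g))

  cofactor : Fin n → Fin n → Fin n
  cofactor g x = nPart (x \\ g)

  cofactor-involution : ∀ g → InvolutionOn (cofactor g) N
  cofactor-involution g {x} x∈N =
    nPart∈N (x \\ g) , proj₁ (factor-unique x∈N (bPart∈B _) x∙b≡y\\g)
    where
    y = cofactor g x
    b = bPart (x \\ g)
    x∙b≡y\\g : x ∙ b ≡ y \\ g
    x∙b≡y\\g = begin
      x ∙ b               ≡⟨ \\-leftDividesʳ y (x ∙ b) ⟨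
      y \\ (y ∙ (x ∙ b))  ≡⟨ cong (y \\_) (x∙yz≈y∙xz y x b) ⟩
      y \\ (x ∙ (y ∙ b))  ≡⟨ cong (λ t → y \\ (x ∙ t)) (nPart∙bPart (x \\ g)) ⟩
      y \\ (x ∙ (x \\ g)) ≡⟨ cong (y \\_) (\\-leftDividesˡ x g) ⟩
      y \\ g              ∎

  cofactor-fixed⇒square : ∀ {g x} → cofactor g x ≡ x → (x ∙ x) ∙ bPart (x \\ g) ≡ g
  cofactor-fixed⇒square {g} {x} x-fixed = begin
    (x ∙ x) ∙ bPart (x \\ g)              ≡⟨ assoc x x _ ⟩
    x ∙ (x ∙ bPart (x \\ g))              ≡⟨ cong (λ t → x ∙ (t ∙ bPart (x \\ g))) x-fixed ⟨
    x ∙ (nPart (x \\ g) ∙ bPart (x \\ g)) ≡⟨ cong (x ∙_) (nPart∙bPart (x \\ g)) ⟩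
    x ∙ (x \\ g)                          ≡⟨ \\-leftDividesˡ x g ⟩
    g                                     ∎

  squareN : Fin n → Fin n
  squareN g = (nPart g ∙ nPart g) ∙ bPart g

  squareN-factored : ∀ {x b} → x ∈ N → b ∈ B → squareN (x ∙ b) ≡ (x ∙ x) ∙ b
  squareN-factored x∈N b∈B with x≡ , b≡ ← factor-unique x∈N b∈B refl =
    cong₂ (λ y c → (y ∙ y) ∙ c) x≡ b≡

  module _ (N-odd : ¬ 2 ∣ ∣ N ∣) where

    cofactor-fixedPoint : ∀ g → ∃ λ x → x ∈ N × cofactor g x ≡ x
    cofactor-fixedPoint g =
      odd⇒involution-has-fixedPoint (cofactor g) (cofactor-involution g) N-odd

    squareN-section : Fin n → Fin n
    squareN-section g = let x = proj₁ (cofactor-fixedPoint g) in x ∙ bPart (x \\ g)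

    squareN∘section≗id : ∀ g → squareN (squareN-section g) ≡ g
    squareN∘section≗id g with x , x∈N , x-fixed ← cofactor-fixedPoint g =
      trans (squareN-factored x∈N (bPart∈B _)) (cofactor-fixed⇒square x-fixed)

    squareN-injective : Injective _≡_ _≡_ squareN
    squareN-injective = section⇒injective squareN∘section≗id

    odd⇒x∙x≡ε⇒x≡ε : ∀ {a} → ε ∈ N → a ∈ N → a ∙ a ≡ ε → a ≡ ε
    odd⇒x∙x≡ε⇒x≡ε {a} ε∈N a∈N a∙a≡ε =
      sym (proj₁ (proj₂ G≡N·B ε b a b ε∈N b∈B a∈N b∈B (squareN-injective squares≡)))
      where
      b = bPart ε
      b∈B = bPart∈B ε
      squares≡ : squareN (ε ∙ b) ≡ squareN (a ∙ b)
      squares≡ = begin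
        squareN (ε ∙ b) ≡⟨ squareN-factored ε∈N b∈B ⟩
        (ε ∙ ε) ∙ b     ≡⟨ cong (_∙ b) (trans (identityˡ ε) (sym a∙a≡ε)) ⟩
        (a ∙ a) ∙ b     ≡⟨ squareN-factored a∈N b∈B ⟨
        squareN (a ∙ b) ∎

proposition5p1 : (n m : ℕ) → 0 < m → n ≡ 2 * m →
    (G : FiniteAbelianGroup n) →
    (N : Subset n) (a : Fin n) →
    a ≢ FiniteAbelianGroup.ε G →
    FiniteAbelianGroup._∙_ G a a ≡ FiniteAbelianGroup.ε G →
    FiniteAbelianGroup.ε G ∈ N → a ∈ N →
    ¬ (2 ∣ ∣ N ∣) →
    ¬ IsDirectFactor G N
proposition5p1 _ _ _ _ G N a a≢ε a∙a≡ε ε∈N a∈N N-odd (_ , _ , G≡N·B) =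
  a≢ε (Factorization.odd⇒x∙x≡ε⇒x≡ε G G≡N·B N-odd ε∈N a∈N a∙a≡ε)
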